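{- For each $m\in\{7,8,10,11\}$, there exists an optimal $2$-D $(m\times 6,3,1)$-OOC with $J^*(m\times 6,3,1)$ codewords.
   Context: Let $I_m=\{0,1,\dots,m-1\}$ and $\mathbb{Z}_n$ the integers modulo $n$. A $2$-D $(m\times n,k,1)$-OOC is a set $\mathcal{C}$ of $k$-subsets of $I_m\times\mathbb{Z}_n$ such that $|A\cap(A+\tau)|\le 1$ for every $A\in\mathcal{C}$ and every integer $\tau\not\equiv 0\pmod n$, and $|A\cap(B+\tau)|\le 1$ for all distinct $A,B\in\mathcal{C}$ and every integer $\tau$, where $B+\tau=\{(i,x+\tau \bmod n):(i,x)\in B\}$. It is optimal if it has the maximum possible number of codewords. $J(m\times n,3,1)=\left\lfloor \frac{m}{3}\left\lfloor\frac{mn-1}{2}\right\rfloor\right\rfloor$. For even $n$, $J^*(m\times n,3,1)=J(m\times n,3,1)-1$ if $mn\equiv 14,20\pmod{24}$, or $m\equiv 4\pmod 6$ and $n=4$, or $m\equiv 5,8\pmod{12}$ and $n=2$, or $m\equiv 0\pmod 3$ and $mn\equiv 6,12\pmod{24}$; and $J^*(m\times n,3,1)=J(m\times n,3,1)$ otherwise. -}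

module Defs where

open import Data.Nat using (ℕ; _+_; _*_; _∸_; _<_; _≤_; NonZero)
open import Data.Nat.DivMod using (_/_; _%_)
open import Data.Nat.Properties using (_≟_)
open import Data.Integer using (ℤ; +_; _%ℕ_)
import Data.Integer as ℤ
open import Data.Product using (_×_; _,_; Σ)
open import Data.Product.Properties using (≡-dec)
open import Data.Sum using (_⊎_)
open import Data.List using (List; length; filter)
open import Data.List.Membership.DecPropositional (≡-dec _≟_ _≟_) using (_∈?_)
open import Data.List.Membership.Propositional using (_∈_)
open import Data.List.Relation.Unary.All using (All)
open import Data.List.Relation.Unary.Unique.Propositional using (Unique)
open import Relation.Binary.PropositionalEquality using (_≡_; _≢_)
open import Relation.Nullary using (¬_)

-- A point (i , x) of I_m × Z_n, represented by natural numbers with i < m, x < n.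
Point : Set
Point = ℕ × ℕ

InGrid : ℕ → ℕ → Point → Set
InGrid m n (i , x) = (i < m) × (x < n)

shift : (n : ℕ) → .{{_ : NonZero n}} → ℤ → Point → Point
shift n τ (i , x) = (i , (+ x ℤ.+ τ) %ℕ n)

shiftSet : (n : ℕ) → .{{_ : NonZero n}} → ℤ → List Point → List Point
shiftSet n τ B = Data.List.map (shift n τ) B

-- |A ∩ B| for A a duplicate-free list of points
∣_∩_∣ : List Point → List Point → ℕ
∣ A ∩ B ∣ = length (filter (λ p → p ∈? B) A)

NonZeroMod : (n : ℕ) → .{{_ : NonZero n}} → ℤ → Set
NonZeroMod n τ = ¬ (τ %ℕ n ≡ 0)

IsKSubset : ℕ → ℕ → ℕ → List Point → Set
IsKSubset m n k A = Unique A × (length A ≡ k) × All (InGrid m n) A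

Is2DOOC : (m n k : ℕ) → .{{_ : NonZero n}} → List (List Point) → Set
Is2DOOC m n k C =
  Unique C
  × All (IsKSubset m n k) C
  × (∀ A → A ∈ C → ∀ τ → NonZeroMod n τ → ∣ A ∩ shiftSet n τ A ∣ ≤ 1)
  × (∀ A B → A ∈ C → B ∈ C → A ≢ B → ∀ τ → ∣ A ∩ shiftSet n τ B ∣ ≤ 1)

IsOptimal2DOOC : (m n k : ℕ) → .{{_ : NonZero n}} → List (List Point) → Set
IsOptimal2DOOC m n k C =
  Is2DOOC m n k C × (∀ C′ → Is2DOOC m n k C′ → length C′ ≤ length C)

-- J(m × n, 3, 1) = ⌊ (m/3) ⌊(mn-1)/2⌋ ⌋ = ⌊ m ⌊(mn-1)/2⌋ / 3 ⌋
J : ℕ → ℕ → ℕ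
J m n = (m * ((m * n ∸ 1) / 2)) / 3

Exceptional : ℕ → ℕ → Set
Exceptional m n =
  ((m * n) % 24 ≡ 14 ⊎ (m * n) % 24 ≡ 20)
  ⊎ (m % 6 ≡ 4 × n ≡ 4)
  ⊎ ((m % 12 ≡ 5 ⊎ m % 12 ≡ 8) × n ≡ 2)
  ⊎ (m % 3 ≡ 0 × ((m * n) % 24 ≡ 6 ⊎ (m * n) % 24 ≡ 12))

-- J*(m × n, 3, 1) for even n, given as a relation: v is the value J* m n.
JStar : ℕ → ℕ → ℕ → Set
JStar m n v = (Exceptional m n × v ≡ J m n ∸ 1) ⊎ (¬ Exceptional m n × v ≡ J m n)

{-# OPTIONS --safe #-}
module Submission where

-- An ordered pair of distinct points (i , a), (j , b) of a codeword has the difference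
-- (i , j , b − a mod n), and two pairs have the same difference exactly when one is a translate of
-- the other. So the correlation constraints say that the k(k − 1)|C| differences of a code are
-- pairwise distinct and avoid every (i , i , d) with 2d ≡ 0; conversely a code with pairwise distinct
-- differences is an OOC. For n = 6 only 6m² − 2m differences remain, whence |C| ≤ J(m × 6, 3, 1);
-- codes of size J with pairwise distinct differences are then checked by evaluation, and J* = J
-- because 6m is not exceptional for m = 7, 8, 10, 11.

open import Defs
open import Data.Nat
  using (ℕ; zero; suc; pred; _+_; _*_; _∸_; _<_; _≤_; z≤n; s≤s; s≤s⁻¹; NonZero; >-nonZero⁻¹; _≟_; _<?_)
open import Data.Nat.DivMod
  using (_%_; %-distribˡ-+; m%n%n≡m%n; [m+n]%n≡m%n; m<n⇒m%n≡m; [m+kn]%n≡m%n; m%n<n)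
open import Data.Nat.Properties
  using (+-assoc; +-comm; +-identityʳ; *-suc; *-zeroʳ; m+[n∸m]≡n; <⇒≤; <⇒≱; ≮⇒≥; m<n⇒m<1+n; *-cancelˡ-<;
         ≤-<-trans; module ≤-Reasoning)
open import Data.Integer using (ℤ; +_; -[1+_]; _-_; -_; _%ℕ_; _/ℕ_)
import Data.Integer as ℤ
open import Data.Integer.DivMod using (a≡a%ℕn+[a/ℕn]*n; n%ℕd<d)
open import Data.Integer.Properties using (pos-*; +-injective)
import Data.Integer.Properties as ℤ
open import Data.Integer.Tactic.RingSolver using (solve-∀)
open import Data.Product using (_×_; _,_; proj₁; proj₂; Σ; Σ-syntax)
open import Data.Product.Properties using (≡-dec)
open import Data.Sum using (_⊎_; inj₁; inj₂)
open import Data.Empty using (⊥; ⊥-elim)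
open import Data.List using (List; []; _∷_; _++_; map; concatMap; filter; length; cartesianProduct; upTo)
open import Data.List.Properties using (length-++; length-++-sucʳ; length-map)
import Data.List.Properties as Listₚ
open import Data.List.Relation.Unary.Any using (here; there)
import Data.List.Relation.Unary.Any as Any
open import Data.List.Relation.Unary.All using (All; []; _∷_; all?)
import Data.List.Relation.Unary.All as All
import Data.List.Relation.Unary.All.Properties as All
open import Data.List.Relation.Unary.AllPairs using ([]; _∷_)
import Data.List.Relation.Unary.AllPairs as AllPairs
import Data.List.Relation.Unary.AllPairs.Properties as AllPairs
open import Data.List.Relation.Unary.Unique.Propositional using (Unique)
open import Data.List.Relation.Unary.Unique.Propositional.Properties using (++⁺; map⁺; concat⁺; filter⁺)
import Data.List.Relation.Unary.Unique.DecPropositional as DecUnique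
open import Data.List.Relation.Binary.Disjoint.Propositional using (Disjoint)
open import Data.List.Relation.Binary.Subset.Propositional using (_⊆_)
open import Data.List.Membership.Propositional using (_∈_; find)
open import Data.List.Membership.Propositional.Properties
  using (∈-map⁺; ∈-map⁻; ∈-++⁺ˡ; ∈-++⁺ʳ; ∈-++⁻; ∈-∃++; ∈-concatMap⁺; ∈-concatMap⁻; ∈-filter⁺; ∈-filter⁻;
         ∈-cartesianProduct⁺; ∈-upTo⁺)
open import Function using (_∘_)
open import Relation.Binary.Definitions using (DecidableEquality)
open import Relation.Binary.PropositionalEquality
  using (_≡_; _≢_; refl; sym; trans; cong; cong₂; subst; module ≡-Reasoning)
open import Relation.Nullary using (Dec; ¬_; yes; no; ¬?)
open import Relation.Nullary.Decidable
  using (True; False; toWitness; toWitnessFalse; _×-dec_; _⊎-dec_)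
open import Relation.Unary using (Decidable)

-- Residues are the naturals below n; the lemmas assume reduced arguments, as _-ₙ_ truncates.
module ℤₙ (n : ℕ) .{{_ : NonZero n}} where

  open ≡-Reasoning

  infixl 6 _+ₙ_ _-ₙ_

  _+ₙ_ : ℕ → ℕ → ℕ
  a +ₙ r = (a + r) % n

  _-ₙ_ : ℕ → ℕ → ℕ
  b -ₙ a = (b + (n ∸ a)) % n

  b-ₙa<n : ∀ a b → b -ₙ a < n
  b-ₙa<n a b = m%n<n (b + (n ∸ a)) n

  [a%n+b]%n≡[a+b]%n : ∀ a b → (a % n + b) % n ≡ (a + b) % n
  [a%n+b]%n≡[a+b]%n a b = begin
    (a % n + b) % n          ≡⟨ %-distribˡ-+ (a % n) b n ⟩
    (a % n % n + b % n) % n  ≡⟨ cong (λ x → (x + b % n) % n) (m%n%n≡m%n a n) ⟩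
    (a % n + b % n) % n      ≡⟨ %-distribˡ-+ a b n ⟨
    (a + b) % n              ∎

  [a+ₙr]+ₙs≡[a+[r+s]]%n : ∀ a r s → (a +ₙ r) +ₙ s ≡ (a + (r + s)) % n
  [a+ₙr]+ₙs≡[a+[r+s]]%n a r s = trans ([a%n+b]%n≡[a+b]%n (a + r) s) (cong (_% n) (+-assoc a r s))

  +ₙ-swapʳ : ∀ a r s → (a +ₙ r) +ₙ s ≡ (a +ₙ s) +ₙ r
  +ₙ-swapʳ a r s = begin
    (a +ₙ r) +ₙ s      ≡⟨ [a+ₙr]+ₙs≡[a+[r+s]]%n a r s ⟩
    (a + (r + s)) % n  ≡⟨ cong (λ x → (a + x) % n) (+-comm r s) ⟩
    (a + (s + r)) % n  ≡⟨ [a+ₙr]+ₙs≡[a+[r+s]]%n a s r ⟨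
    (a +ₙ s) +ₙ r      ∎

  a+ₙ0≡a : ∀ {a} → a < n → a +ₙ 0 ≡ a
  a+ₙ0≡a {a} a<n = trans (cong (_% n) (+-identityʳ a)) (m<n⇒m%n≡m a<n)

  a+ₙ[b-ₙa]≡b : ∀ {a b} → a < n → b < n → a +ₙ (b -ₙ a) ≡ b
  a+ₙ[b-ₙa]≡b {a} {b} a<n b<n = begin
    (a + (b + (n ∸ a)) % n) % n  ≡⟨ cong (_% n) (+-comm a _) ⟩
    ((b + (n ∸ a)) % n + a) % n  ≡⟨ [a%n+b]%n≡[a+b]%n (b + (n ∸ a)) a ⟩
    (b + (n ∸ a) + a) % n        ≡⟨ cong (_% n) (+-assoc b (n ∸ a) a) ⟩
    (b + ((n ∸ a) + a)) % n      ≡⟨ cong (λ x → (b + x) % n) (trans (+-comm (n ∸ a) a) (m+[n∸m]≡n (<⇒≤ a<n))) ⟩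
    (b + n) % n                  ≡⟨ [m+n]%n≡m%n b n ⟩
    b % n                        ≡⟨ m<n⇒m%n≡m b<n ⟩
    b                            ∎

  [a+ₙr]-ₙa≡r : ∀ {a r} → a < n → r < n → (a +ₙ r) -ₙ a ≡ r
  [a+ₙr]-ₙa≡r {a} {r} a<n r<n = begin
    ((a + r) % n + (n ∸ a)) % n  ≡⟨ [a%n+b]%n≡[a+b]%n (a + r) (n ∸ a) ⟩
    (a + r + (n ∸ a)) % n        ≡⟨ cong (λ x → (x + (n ∸ a)) % n) (+-comm a r) ⟩
    (r + a + (n ∸ a)) % n        ≡⟨ cong (_% n) (+-assoc r a (n ∸ a)) ⟩
    (r + (a + (n ∸ a))) % n      ≡⟨ cong (λ x → (r + x) % n) (m+[n∸m]≡n (<⇒≤ a<n)) ⟩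
    (r + n) % n                  ≡⟨ [m+n]%n≡m%n r n ⟩
    r % n                        ≡⟨ m<n⇒m%n≡m r<n ⟩
    r                            ∎

  a+ₙr≡a⇒r≡0 : ∀ {a r} → a < n → r < n → a +ₙ r ≡ a → r ≡ 0
  a+ₙr≡a⇒r≡0 {a} {r} a<n r<n a+ₙr≡a = begin
    r               ≡⟨ [a+ₙr]-ₙa≡r a<n r<n ⟨
    (a +ₙ r) -ₙ a   ≡⟨ cong (_-ₙ a) (trans a+ₙr≡a (sym (a+ₙ0≡a a<n))) ⟩
    (a +ₙ 0) -ₙ a   ≡⟨ [a+ₙr]-ₙa≡r a<n (>-nonZero⁻¹ n) ⟩
    0               ∎

  [b+ₙr]-ₙ[a+ₙr]≡b-ₙa : ∀ r {a b} → a < n → b < n → (b +ₙ r) -ₙ (a +ₙ r) ≡ b -ₙ a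
  [b+ₙr]-ₙ[a+ₙr]≡b-ₙa r {a} {b} a<n b<n = begin
    (b +ₙ r) -ₙ (a +ₙ r)                ≡⟨ cong (λ x → (x +ₙ r) -ₙ (a +ₙ r)) (a+ₙ[b-ₙa]≡b a<n b<n) ⟨
    ((a +ₙ d) +ₙ r) -ₙ (a +ₙ r)         ≡⟨ cong (_-ₙ (a +ₙ r)) (+ₙ-swapʳ a d r) ⟩
    ((a +ₙ r) +ₙ d) -ₙ (a +ₙ r)         ≡⟨ [a+ₙr]-ₙa≡r (m%n<n (a + r) n) (b-ₙa<n a b) ⟩
    d                                   ∎
    where d = b -ₙ a

  b-ₙa≡b′-ₙa′⇒b′+ₙ[a-ₙa′]≡b : ∀ {a b a′ b′} → a < n → b < n → a′ < n → b′ < n →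
                              b -ₙ a ≡ b′ -ₙ a′ → b′ +ₙ (a -ₙ a′) ≡ b
  b-ₙa≡b′-ₙa′⇒b′+ₙ[a-ₙa′]≡b {a} {b} {a′} {b′} a<n b<n a′<n b′<n same-d = begin
    b′ +ₙ (a -ₙ a′)                   ≡⟨ cong (_+ₙ (a -ₙ a′)) (a+ₙ[b-ₙa]≡b a′<n b′<n) ⟨
    (a′ +ₙ (b′ -ₙ a′)) +ₙ (a -ₙ a′)   ≡⟨ +ₙ-swapʳ a′ (b′ -ₙ a′) (a -ₙ a′) ⟩
    (a′ +ₙ (a -ₙ a′)) +ₙ (b′ -ₙ a′)   ≡⟨ cong₂ _+ₙ_ (a+ₙ[b-ₙa]≡b a′<n a<n) (sym same-d) ⟩
    a +ₙ (b -ₙ a)                     ≡⟨ a+ₙ[b-ₙa]≡b a<n b<n ⟩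
    b                                 ∎

  b+ₙ[b-ₙa]≡a : ∀ {a b} → a < n → b < n → ((b -ₙ a) + (b -ₙ a)) % n ≡ 0 → b +ₙ (b -ₙ a) ≡ a
  b+ₙ[b-ₙa]≡a {a} {b} a<n b<n 2d≡0 = begin
    b +ₙ d                 ≡⟨ cong (_+ₙ d) (a+ₙ[b-ₙa]≡b a<n b<n) ⟨
    (a +ₙ d) +ₙ d          ≡⟨ [a+ₙr]+ₙs≡[a+[r+s]]%n a d d ⟩
    (a + (d + d)) % n      ≡⟨ cong (_% n) (+-comm a (d + d)) ⟩
    ((d + d) + a) % n      ≡⟨ [a%n+b]%n≡[a+b]%n (d + d) a ⟨
    ((d + d) % n + a) % n  ≡⟨ cong (λ x → (x + a) % n) 2d≡0 ⟩
    a % n                  ≡⟨ m<n⇒m%n≡m a<n ⟩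
    a                      ∎
    where d = b -ₙ a

  a≡b+kn⇒a%n≡b%n : ∀ a b k → a ≡ b + k * n → a % n ≡ b % n
  a≡b+kn⇒a%n≡b%n a b k refl = [m+kn]%n≡m%n b k n

  +a≡+b+dn⇒a%n≡b%n : ∀ a b d → + a ≡ + b ℤ.+ d ℤ.* + n → a % n ≡ b % n
  +a≡+b+dn⇒a%n≡b%n a b (+ k) eq =
    a≡b+kn⇒a%n≡b%n a b k (+-injective (trans eq (cong (λ x → + b ℤ.+ x) (sym (pos-* k n)))))
  +a≡+b+dn⇒a%n≡b%n a b -[1+ k ] eq = sym (a≡b+kn⇒a%n≡b%n b a (suc k) (+-injective (begin
    + b                                             ≡⟨ move (+ b) -[1+ k ] (+ n) ⟩
    + b ℤ.+ -[1+ k ] ℤ.* + n ℤ.+ + suc k ℤ.* + n    ≡⟨ cong (ℤ._+ + suc k ℤ.* + n) eq ⟨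
    + a ℤ.+ + suc k ℤ.* + n                         ≡⟨ cong (λ x → + a ℤ.+ x) (pos-* (suc k) n) ⟨
    + (a + suc k * n)                               ∎)))
    where
    move : ∀ b d m → b ≡ b ℤ.+ d ℤ.* m ℤ.+ (- d) ℤ.* m
    move = solve-∀

  z≡a+cn⇒z%ℕn≡a%n : ∀ z a c → z ≡ + a ℤ.+ c ℤ.* + n → z %ℕ n ≡ a % n
  z≡a+cn⇒z%ℕn≡a%n z a c z≡a+cn = begin
    z %ℕ n      ≡⟨ m<n⇒m%n≡m (n%ℕd<d z n) ⟨
    z %ℕ n % n  ≡⟨ +a≡+b+dn⇒a%n≡b%n a (z %ℕ n) (z /ℕ n - c) a≡r+[q-c]n ⟨
    a % n       ∎
    where
    shuffle : ∀ a c m → a ≡ a ℤ.+ c ℤ.* m - c ℤ.* m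
    shuffle = solve-∀
    regroup : ∀ r q c m → r ℤ.+ q ℤ.* m - c ℤ.* m ≡ r ℤ.+ (q - c) ℤ.* m
    regroup = solve-∀
    a≡r+[q-c]n : + a ≡ + (z %ℕ n) ℤ.+ (z /ℕ n - c) ℤ.* + n
    a≡r+[q-c]n = begin
      + a                                          ≡⟨ shuffle (+ a) c (+ n) ⟩
      + a ℤ.+ c ℤ.* + n - c ℤ.* + n                ≡⟨ cong (_- c ℤ.* + n) z≡a+cn ⟨
      z - c ℤ.* + n                                ≡⟨ cong (_- c ℤ.* + n) (a≡a%ℕn+[a/ℕn]*n z n) ⟩
      + (z %ℕ n) ℤ.+ z /ℕ n ℤ.* + n - c ℤ.* + n    ≡⟨ regroup (+ (z %ℕ n)) (z /ℕ n) c (+ n) ⟩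
      + (z %ℕ n) ℤ.+ (z /ℕ n - c) ℤ.* + n          ∎

  [x+τ]%ℕn≡x+ₙ[τ%ℕn] : ∀ x τ → (+ x ℤ.+ τ) %ℕ n ≡ x +ₙ (τ %ℕ n)
  [x+τ]%ℕn≡x+ₙ[τ%ℕn] x τ = z≡a+cn⇒z%ℕn≡a%n (+ x ℤ.+ τ) (x + τ %ℕ n) (τ /ℕ n) (begin
    + x ℤ.+ τ                                  ≡⟨ cong (λ t → + x ℤ.+ t) (a≡a%ℕn+[a/ℕn]*n τ n) ⟩
    + x ℤ.+ (+ (τ %ℕ n) ℤ.+ τ /ℕ n ℤ.* + n)    ≡⟨ ℤ.+-assoc (+ x) (+ (τ %ℕ n)) (τ /ℕ n ℤ.* + n) ⟨
    + (x + τ %ℕ n) ℤ.+ τ /ℕ n ℤ.* + n          ∎)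

module _ {X Y : Set} {f : X → Y} where

  Unique-map⁺ : ∀ {xs} → (∀ {x y} → x ∈ xs → y ∈ xs → f x ≡ f y → x ≡ y) → Unique xs →
                Unique (map f xs)
  Unique-map⁺ _ [] = []
  Unique-map⁺ inj (x∉xs ∷ xs!) =
    All.map⁺ (All.tabulate (λ y∈xs fx≡fy → All.lookup x∉xs y∈xs (inj (here refl) (there y∈xs) fx≡fy)))
    ∷ Unique-map⁺ (λ x∈xs y∈xs → inj (there x∈xs) (there y∈xs)) xs!

  Unique-map⇒injective : ∀ {xs x y} → Unique (map f xs) → x ∈ xs → y ∈ xs → f x ≡ f y → x ≡ y
  Unique-map⇒injective _ (here refl) (here refl) _ = refl
  Unique-map⇒injective (fx∉ ∷ _) (here refl) (there y∈xs) fx≡fy =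
    ⊥-elim (All.lookup fx∉ (∈-map⁺ f y∈xs) fx≡fy)
  Unique-map⇒injective (fy∉ ∷ _) (there x∈xs) (here refl) fx≡fy =
    ⊥-elim (All.lookup fy∉ (∈-map⁺ f x∈xs) (sym fx≡fy))
  Unique-map⇒injective (_ ∷ fxs!) (there x∈xs) (there y∈xs) fx≡fy =
    Unique-map⇒injective fxs! x∈xs y∈xs fx≡fy

module _ {X : Set} where

  distinct-members⇒1<length : ∀ {xs : List X} {x y} → x ∈ xs → y ∈ xs → x ≢ y → 1 < length xs
  distinct-members⇒1<length (here refl) (here refl) x≢y = ⊥-elim (x≢y refl)
  distinct-members⇒1<length {_ ∷ _ ∷ _} (here _) (there _) _ = s≤s (s≤s z≤n)
  distinct-members⇒1<length {_ ∷ _ ∷ _} (there _) (here _) _ = s≤s (s≤s z≤n)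
  distinct-members⇒1<length (there x∈xs) (there y∈xs) x≢y =
    m<n⇒m<1+n (distinct-members⇒1<length x∈xs y∈xs x≢y)

  Unique⇒length≤ : ∀ {xs ys : List X} → Unique xs → xs ⊆ ys → length xs ≤ length ys
  Unique⇒length≤ {[]} _ _ = z≤n
  Unique⇒length≤ {x ∷ xs} (x∉xs ∷ xs!) xs⊆ys with ∈-∃++ (xs⊆ys (here refl))
  ... | ys₁ , ys₂ , refl =
    subst (suc (length xs) ≤_) (sym (length-++-sucʳ ys₁ x ys₂)) (s≤s (Unique⇒length≤ xs! xs⊆ys₁++ys₂))
    where
    xs⊆ys₁++ys₂ : xs ⊆ ys₁ ++ ys₂
    xs⊆ys₁++ys₂ y∈xs with ∈-++⁻ ys₁ (xs⊆ys (there y∈xs))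
    ... | inj₁ y∈ys₁ = ∈-++⁺ˡ y∈ys₁
    ... | inj₂ (here refl) = ⊥-elim (All.lookup x∉xs y∈xs refl)
    ... | inj₂ (there y∈ys₂) = ∈-++⁺ʳ ys₁ y∈ys₂

  1<length⇒distinct-members : ∀ {xs : List X} → Unique xs → 1 < length xs →
                              Σ[ x ∈ X ] Σ[ y ∈ X ] (x ∈ xs × y ∈ xs × x ≢ y)
  1<length⇒distinct-members {x ∷ y ∷ _} ((x≢y ∷ _) ∷ _) _ = x , y , here refl , there (here refl) , x≢y
  1<length⇒distinct-members {_ ∷ []} _ (s≤s ())

  offDiagonal : List X → List (X × X)
  offDiagonal [] = []
  offDiagonal (x ∷ xs) = map (x ,_) xs ++ map (_, x) xs ++ offDiagonal xs

  ∈-offDiagonal⁺ : ∀ {xs : List X} {x y} → x ∈ xs → y ∈ xs → x ≢ y → (x , y) ∈ offDiagonal xs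
  ∈-offDiagonal⁺ (here refl) (here refl) x≢y = ⊥-elim (x≢y refl)
  ∈-offDiagonal⁺ (here refl) (there y∈xs) _ = ∈-++⁺ˡ (∈-map⁺ _ y∈xs)
  ∈-offDiagonal⁺ {_ ∷ xs} (there x∈xs) (here refl) _ = ∈-++⁺ʳ (map _ xs) (∈-++⁺ˡ (∈-map⁺ _ x∈xs))
  ∈-offDiagonal⁺ {_ ∷ xs} (there x∈xs) (there y∈xs) x≢y =
    ∈-++⁺ʳ (map _ xs) (∈-++⁺ʳ (map _ xs) (∈-offDiagonal⁺ x∈xs y∈xs x≢y))

  ∈-offDiagonal⁻ : ∀ {xs : List X} {x y} → Unique xs → (x , y) ∈ offDiagonal xs →
                   x ∈ xs × y ∈ xs × x ≢ y
  ∈-offDiagonal⁻ {z ∷ xs} (z∉xs ∷ xs!) xy∈ with ∈-++⁻ (map (z ,_) xs) xy∈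
  ... | inj₁ xy∈₁ with ∈-map⁻ (z ,_) xy∈₁
  ...   | y , y∈xs , refl = here refl , there y∈xs , All.lookup z∉xs y∈xs
  ∈-offDiagonal⁻ {z ∷ xs} (z∉xs ∷ xs!) xy∈ | inj₂ xy∈₂ with ∈-++⁻ (map (_, z) xs) xy∈₂
  ...   | inj₁ xy∈₂₁ with ∈-map⁻ (_, z) xy∈₂₁
  ...     | x , x∈xs , refl = there x∈xs , here refl , (λ x≡z → All.lookup z∉xs x∈xs (sym x≡z))
  ∈-offDiagonal⁻ {z ∷ xs} (z∉xs ∷ xs!) xy∈ | inj₂ xy∈₂ | inj₂ xy∈₂₂ =
    let x∈xs , y∈xs , x≢y = ∈-offDiagonal⁻ xs! xy∈₂₂ in there x∈xs , there y∈xs , x≢y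

  Unique-offDiagonal : ∀ {xs : List X} → Unique xs → Unique (offDiagonal xs)
  Unique-offDiagonal [] = []
  Unique-offDiagonal {x ∷ xs} (x∉xs ∷ xs!) =
    ++⁺ (map⁺ (cong proj₂) xs!) (++⁺ (map⁺ (cong proj₁) xs!) (Unique-offDiagonal xs!) disjoint₂) disjoint₁
    where
    x∉ : ∀ {z} → z ∈ xs → x ≢ z
    x∉ = All.lookup x∉xs
    disjoint₁ : Disjoint (map (x ,_) xs) (map (_, x) xs ++ offDiagonal xs)
    disjoint₁ (p∈₁ , p∈₂) with ∈-map⁻ (x ,_) p∈₁ | ∈-++⁻ (map (_, x) xs) p∈₂
    ... | _ , _ , refl | inj₁ p∈ with ∈-map⁻ (_, x) p∈
    ...   | _ , z∈xs , refl = x∉ z∈xs refl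
    disjoint₁ (p∈₁ , p∈₂) | _ , _ , refl | inj₂ p∈ = x∉ (proj₁ (∈-offDiagonal⁻ xs! p∈)) refl
    disjoint₂ : Disjoint (map (_, x) xs) (offDiagonal xs)
    disjoint₂ (p∈₁ , p∈₂) with ∈-map⁻ (_, x) p∈₁
    ... | _ , _ , refl = x∉ (proj₁ (proj₂ (∈-offDiagonal⁻ xs! p∈₂))) refl

  length-offDiagonal : ∀ (xs : List X) → length (offDiagonal xs) ≡ length xs * pred (length xs)
  length-offDiagonal [] = refl
  length-offDiagonal (x ∷ xs) = begin
    length (map (x ,_) xs ++ map (_, x) xs ++ offDiagonal xs)  ≡⟨ length-++ (map (x ,_) xs) ⟩
    length (map (x ,_) xs) + length (map (_, x) xs ++ offDiagonal xs)
      ≡⟨ cong₂ _+_ (length-map (x ,_) xs) (length-++ (map (_, x) xs)) ⟩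
    k + (length (map (_, x) xs) + length (offDiagonal xs))
      ≡⟨ cong (λ t → k + t) (cong₂ _+_ (length-map (_, x) xs) (length-offDiagonal xs)) ⟩
    k + (k + k * pred k)                                        ≡⟨ cong (λ t → k + t) (m+m*pred[m]≡m*m k) ⟩
    k + k * k                                                   ∎
    where
    open ≡-Reasoning
    k = length xs
    m+m*pred[m]≡m*m : ∀ m → m + m * pred m ≡ m * m
    m+m*pred[m]≡m*m zero = refl
    m+m*pred[m]≡m*m (suc m) = sym (*-suc (suc m) m)

  labelledOffDiagonal : List (List X) → List (List X × X × X)
  labelledOffDiagonal = concatMap (λ xs → map (xs ,_) (offDiagonal xs))

  ∈-labelledOffDiagonal⁺ : ∀ {xss : List (List X)} {xs x y} →
                           xs ∈ xss → (x , y) ∈ offDiagonal xs → (xs , x , y) ∈ labelledOffDiagonal xss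
  ∈-labelledOffDiagonal⁺ xs∈xss xy∈ = ∈-concatMap⁺ _ (Any.map (λ { refl → ∈-map⁺ _ xy∈ }) xs∈xss)

  ∈-labelledOffDiagonal⁻ : ∀ {xss : List (List X)} {xs x y} → All Unique xss →
                           (xs , x , y) ∈ labelledOffDiagonal xss → xs ∈ xss × x ∈ xs × y ∈ xs × x ≢ y
  ∈-labelledOffDiagonal⁻ all! p∈ with find (∈-concatMap⁻ _ p∈)
  ... | ys , ys∈xss , p∈ys with ∈-map⁻ (ys ,_) p∈ys
  ...   | _ , xy∈ , refl = ys∈xss , ∈-offDiagonal⁻ (All.lookup all! ys∈xss) xy∈

  Unique-labelledOffDiagonal : ∀ {xss : List (List X)} → Unique xss → All Unique xss →
                               Unique (labelledOffDiagonal xss)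
  Unique-labelledOffDiagonal xss! all! =
    concat⁺ (All.map⁺ (All.map (λ xs! → map⁺ (cong proj₂) (Unique-offDiagonal xs!)) all!))
            (AllPairs.map⁺ (AllPairs.map labels-differ xss!))
    where
    labels-differ : ∀ {xs ys} → xs ≢ ys →
                    Disjoint (map (xs ,_) (offDiagonal xs)) (map (ys ,_) (offDiagonal ys))
    labels-differ xs≢ys (p∈₁ , p∈₂) with ∈-map⁻ _ p∈₁ | ∈-map⁻ _ p∈₂
    ... | _ , _ , refl | _ , _ , eq = xs≢ys (cong proj₁ eq)

  length-labelledOffDiagonal : ∀ {k} (xss : List (List X)) → All (λ xs → length xs ≡ k) xss →
                               length (labelledOffDiagonal xss) ≡ k * pred k * length xss
  length-labelledOffDiagonal {k} [] [] = sym (*-zeroʳ (k * pred k))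
  length-labelledOffDiagonal {k} (xs ∷ xss) (refl ∷ lengths) = begin
    length (map (xs ,_) (offDiagonal xs) ++ labelledOffDiagonal xss)
      ≡⟨ length-++ (map (xs ,_) (offDiagonal xs)) ⟩
    length (map (xs ,_) (offDiagonal xs)) + length (labelledOffDiagonal xss)
      ≡⟨ cong₂ _+_ (trans (length-map _ (offDiagonal xs)) (length-offDiagonal xs))
                   (length-labelledOffDiagonal xss lengths) ⟩
    k * pred k + k * pred k * length xss  ≡⟨ *-suc (k * pred k) (length xss) ⟨
    k * pred k * suc (length xss)         ∎
    where open ≡-Reasoning

_≟ₚ_ : DecidableEquality Point
_≟ₚ_ = ≡-dec _≟_ _≟_

_≟ₗ_ : DecidableEquality (List Point)
_≟ₗ_ = Listₚ.≡-dec _≟ₚ_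

-- The membership test ∣_∩_∣ filters with; lemmas about that filter must use the same one.
open import Data.List.Membership.DecPropositional _≟ₚ_ using (_∈?_)

module Differences (n : ℕ) .{{_ : NonZero n}} where

  open ℤₙ n

  translate : ℕ → Point → Point
  translate r (i , x) = (i , x +ₙ r)

  translate-by-zero : ∀ {r p q} → r ≡ 0 → proj₂ p < n → translate r p ≡ q → p ≡ q
  translate-by-zero refl x<n refl = cong (_ ,_) (sym (a+ₙ0≡a x<n))

  shift≡translate : ∀ τ p → shift n τ p ≡ translate (τ %ℕ n) p
  shift≡translate τ (i , x) = cong (i ,_) ([x+τ]%ℕn≡x+ₙ[τ%ℕn] x τ)

  Difference : Set
  Difference = ℕ × ℕ × ℕ

  _≟ᵈ_ : DecidableEquality Difference
  _≟ᵈ_ = ≡-dec _≟_ (≡-dec _≟_ _≟_)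

  Δ : Point → Point → Difference
  Δ (i , a) (j , b) = (i , j , b -ₙ a)

  Δ-translate : ∀ r {i j a b} → a < n → b < n →
                Δ (translate r (i , a)) (translate r (j , b)) ≡ Δ (i , a) (j , b)
  Δ-translate r a<n b<n = cong (λ d → _ , _ , d) ([b+ₙr]-ₙ[a+ₙr]≡b-ₙa r a<n b<n)

  Δ≡⇒translate : ∀ {i j a b i′ j′ a′ b′} → a < n → b < n → a′ < n → b′ < n →
                 Δ (i , a) (j , b) ≡ Δ (i′ , a′) (j′ , b′) →
                 translate (a -ₙ a′) (i′ , a′) ≡ (i , a) × translate (a -ₙ a′) (j′ , b′) ≡ (j , b)
  Δ≡⇒translate a<n b<n a′<n b′<n Δ≡ with cong proj₁ Δ≡ | cong (proj₁ ∘ proj₂) Δ≡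
  ... | refl | refl = cong (_ ,_) (a+ₙ[b-ₙa]≡b a′<n a<n)
                    , cong (_ ,_) (b-ₙa≡b′-ₙa′⇒b′+ₙ[a-ₙa′]≡b a<n b<n a′<n b′<n (cong (proj₂ ∘ proj₂) Δ≡))

  translated-pair⇒1<∣∩∣ : ∀ {A B : List Point} {r u v u′ v′} → u ∈ A → v ∈ A → u ≢ v → u′ ∈ B → v′ ∈ B →
                          translate r u′ ≡ u → translate r v′ ≡ v → 1 < ∣ A ∩ shiftSet n (+ r) B ∣
  translated-pair⇒1<∣∩∣ {B = B} {r} u∈A v∈A u≢v u′∈B v′∈B refl refl =
    distinct-members⇒1<length (∈-filter⁺ (_∈? shiftSet n (+ r) B) u∈A (∈-map⁺ _ u′∈B))
                              (∈-filter⁺ (_∈? shiftSet n (+ r) B) v∈A (∈-map⁺ _ v′∈B)) u≢v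

  no-translated-pair⇒∣∩∣≤1 : ∀ {A B : List Point} τ → Unique A →
    (∀ {u v u′ v′} → (u , v) ∈ offDiagonal A → (u′ , v′) ∈ offDiagonal B →
       translate (τ %ℕ n) u′ ≡ u → translate (τ %ℕ n) v′ ≡ v → ⊥) →
    ∣ A ∩ shiftSet n τ B ∣ ≤ 1
  no-translated-pair⇒∣∩∣≤1 {A} {B} τ A! no-pair = ≮⇒≥ λ 1<∣∩∣ →
    let u , v , u∈ , v∈ , u≢v = 1<length⇒distinct-members (filter⁺ (_∈? shiftSet n τ B) A!) 1<∣∩∣
        u∈A , u∈B+τ = ∈-filter⁻ (_∈? shiftSet n τ B) {xs = A} u∈
        v∈A , v∈B+τ = ∈-filter⁻ (_∈? shiftSet n τ B) {xs = A} v∈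
        u′ , u′∈B , u≡ = ∈-map⁻ (shift n τ) u∈B+τ
        v′ , v′∈B , v≡ = ∈-map⁻ (shift n τ) v∈B+τ
        u′≢v′ = λ u′≡v′ → u≢v (trans u≡ (trans (cong (shift n τ) u′≡v′) (sym v≡)))
    in no-pair (∈-offDiagonal⁺ u∈A v∈A u≢v) (∈-offDiagonal⁺ u′∈B v′∈B u′≢v′)
               (trans (sym (shift≡translate τ u′)) (sym u≡))
               (trans (sym (shift≡translate τ v′)) (sym v≡))

  -- (i , i , d) with 2d ≡ 0 cannot occur: for d = 0 the two points coincide, and otherwise the
  -- codeword meets its translate by d in both of them.
  Admissible : Difference → Set
  Admissible (i , j , d) = ¬ (i ≡ j × (d + d) % n ≡ 0)

  admissible? : Decidable Admissible
  admissible? (i , j , d) = ¬? ((i ≟ j) ×-dec ((d + d) % n ≟ 0))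

  admissibleDifferences : ℕ → List Difference
  admissibleDifferences m =
    filter admissible? (cartesianProduct (upTo m) (cartesianProduct (upTo m) (upTo n)))

  labelledΔ : List Point × Point × Point → Difference
  labelledΔ (_ , u , v) = Δ u v

  differences : List (List Point) → List Difference
  differences C = map labelledΔ (labelledOffDiagonal C)

  Δ-admissible : ∀ {A : List Point} {i j a b} → (∀ τ → NonZeroMod n τ → ∣ A ∩ shiftSet n τ A ∣ ≤ 1) →
                 (i , a) ∈ A → (j , b) ∈ A → (i , a) ≢ (j , b) → a < n → b < n →
                 Admissible (Δ (i , a) (j , b))
  Δ-admissible {i = i} {a = a} {b} auto u∈A v∈A u≢v a<n b<n (refl , 2d≡0) with b -ₙ a ≟ 0
  ... | yes d≡0 = u≢v (cong (i ,_) (begin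
    a              ≡⟨ a+ₙ0≡a a<n ⟨
    a +ₙ 0         ≡⟨ cong (a +ₙ_) d≡0 ⟨
    a +ₙ (b -ₙ a)  ≡⟨ a+ₙ[b-ₙa]≡b a<n b<n ⟩
    b              ∎))
    where open ≡-Reasoning
  ... | no d≢0 = <⇒≱
    (translated-pair⇒1<∣∩∣ u∈A v∈A u≢v v∈A u∈A
       (cong (i ,_) (b+ₙ[b-ₙa]≡a a<n b<n 2d≡0)) (cong (i ,_) (a+ₙ[b-ₙa]≡b a<n b<n)))
    (auto (+ (b -ₙ a)) (d≢0 ∘ trans (sym (m<n⇒m%n≡m (b-ₙa<n a b)))))

  module _ {m k : ℕ} {C : List (List Point)} where

    ∈⇒InGrid : All (IsKSubset m n k) C → ∀ {A u} → A ∈ C → u ∈ A → InGrid m n u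
    ∈⇒InGrid ks A∈C = All.lookup (proj₂ (proj₂ (All.lookup ks A∈C)))

    Is2DOOC⇒translate-trivial : Is2DOOC m n k C → ∀ {A B r} → A ∈ C → B ∈ C → r < n →
                                1 < ∣ A ∩ shiftSet n (+ r) B ∣ → A ≡ B × r ≡ 0
    Is2DOOC⇒translate-trivial (_ , _ , auto , cross) {A} {B} {r} A∈C B∈C r<n 1<∣∩∣
      with A ≟ₗ B | r ≟ 0
    ... | no A≢B   | _       = ⊥-elim (<⇒≱ 1<∣∩∣ (cross A B A∈C B∈C A≢B (+ r)))
    ... | yes refl | no r≢0  = ⊥-elim (<⇒≱ 1<∣∩∣ (auto A A∈C (+ r) (r≢0 ∘ trans (sym (m<n⇒m%n≡m r<n)))))
    ... | yes refl | yes r≡0 = refl , r≡0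

    Is2DOOC⇒Δ-injective : Is2DOOC m n k C → ∀ {p q} →
                          p ∈ labelledOffDiagonal C → q ∈ labelledOffDiagonal C → labelledΔ p ≡ labelledΔ q → p ≡ q
    Is2DOOC⇒Δ-injective ooc@(_ , ks , _ , _) {A , u , v} {B , u′ , v′} p∈ q∈ Δ≡ =
      let A∈C , u∈A , v∈A , u≢v = ∈-labelledOffDiagonal⁻ (All.map proj₁ ks) p∈
          B∈C , u′∈B , v′∈B , _ = ∈-labelledOffDiagonal⁻ (All.map proj₁ ks) q∈
          _ , a<n = ∈⇒InGrid ks A∈C u∈A
          _ , b<n = ∈⇒InGrid ks A∈C v∈A
          _ , a′<n = ∈⇒InGrid ks B∈C u′∈B
          _ , b′<n = ∈⇒InGrid ks B∈C v′∈B
          u′↦u , v′↦v = Δ≡⇒translate a<n b<n a′<n b′<n Δ≡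
          A≡B , r≡0 = Is2DOOC⇒translate-trivial ooc A∈C B∈C (b-ₙa<n (proj₂ u′) (proj₂ u))
                        (translated-pair⇒1<∣∩∣ u∈A v∈A u≢v u′∈B v′∈B u′↦u v′↦v)
      in cong₂ _,_ A≡B (cong₂ _,_ (sym (translate-by-zero r≡0 a′<n u′↦u))
                                  (sym (translate-by-zero r≡0 b′<n v′↦v)))

    Is2DOOC⇒admissible : Is2DOOC m n k C → ∀ {p} → p ∈ labelledOffDiagonal C →
                         labelledΔ p ∈ admissibleDifferences m
    Is2DOOC⇒admissible (_ , ks , auto , _) {A , u , v} p∈ =
      let A∈C , u∈A , v∈A , u≢v = ∈-labelledOffDiagonal⁻ (All.map proj₁ ks) p∈
          i<m , a<n = ∈⇒InGrid ks A∈C u∈A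
          j<m , b<n = ∈⇒InGrid ks A∈C v∈A
      in ∈-filter⁺ admissible?
           (∈-cartesianProduct⁺ (∈-upTo⁺ i<m)
              (∈-cartesianProduct⁺ (∈-upTo⁺ j<m) (∈-upTo⁺ (b-ₙa<n (proj₂ u) (proj₂ v)))))
           (Δ-admissible (auto A A∈C) u∈A v∈A u≢v a<n b<n)

    Is2DOOC⇒size≤ : Is2DOOC m n k C → k * pred k * length C ≤ length (admissibleDifferences m)
    Is2DOOC⇒size≤ ooc@(C! , ks , _ , _) = begin
      k * pred k * length C               ≡⟨ length-labelledOffDiagonal C (All.map (proj₁ ∘ proj₂) ks) ⟨
      length (labelledOffDiagonal C)      ≡⟨ length-map labelledΔ (labelledOffDiagonal C) ⟨
      length (differences C)              ≤⟨ Unique⇒length≤ differences! differences⊆admissible ⟩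
      length (admissibleDifferences m)    ∎
      where
      open ≤-Reasoning
      differences! : Unique (differences C)
      differences! =
        Unique-map⁺ (Is2DOOC⇒Δ-injective ooc) (Unique-labelledOffDiagonal C! (All.map proj₁ ks))
      differences⊆admissible : differences C ⊆ admissibleDifferences m
      differences⊆admissible d∈ with ∈-map⁻ labelledΔ d∈
      ... | _ , p∈ , refl = Is2DOOC⇒admissible ooc p∈

    Unique-differences⇒Is2DOOC : Unique C → All (IsKSubset m n k) C → Unique (differences C) →
                                 Is2DOOC m n k C
    Unique-differences⇒Is2DOOC C! ks differences! = C! , ks , autocorrelation , crosscorrelation
      where
      translated-pair⇒same : ∀ r {A B u v u′ v′} → A ∈ C → B ∈ C →
                             (u , v) ∈ offDiagonal A → (u′ , v′) ∈ offDiagonal B →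
                             translate r u′ ≡ u → translate r v′ ≡ v → (A , u , v) ≡ (B , u′ , v′)
      translated-pair⇒same r A∈C B∈C uv∈ u′v′∈ refl refl =
        let u′∈B , v′∈B , _ = ∈-offDiagonal⁻ (proj₁ (All.lookup ks B∈C)) u′v′∈
        in Unique-map⇒injective differences!
             (∈-labelledOffDiagonal⁺ A∈C uv∈) (∈-labelledOffDiagonal⁺ B∈C u′v′∈)
             (Δ-translate r (proj₂ (∈⇒InGrid ks B∈C u′∈B)) (proj₂ (∈⇒InGrid ks B∈C v′∈B)))
      autocorrelation : ∀ A → A ∈ C → ∀ τ → NonZeroMod n τ → ∣ A ∩ shiftSet n τ A ∣ ≤ 1
      autocorrelation A A∈C τ τ≢0 =
        no-translated-pair⇒∣∩∣≤1 τ (proj₁ (All.lookup ks A∈C)) λ uv∈ u′v′∈ u′↦u v′↦v →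
          let u′∈A , _ = ∈-offDiagonal⁻ (proj₁ (All.lookup ks A∈C)) u′v′∈
              u≡u′ = cong (proj₁ ∘ proj₂) (translated-pair⇒same (τ %ℕ n) A∈C A∈C uv∈ u′v′∈ u′↦u v′↦v)
          in τ≢0 (a+ₙr≡a⇒r≡0 (proj₂ (∈⇒InGrid ks A∈C u′∈A)) (n%ℕd<d τ n) (cong proj₂ (trans u′↦u u≡u′)))
      crosscorrelation : ∀ A B → A ∈ C → B ∈ C → A ≢ B → ∀ τ → ∣ A ∩ shiftSet n τ B ∣ ≤ 1
      crosscorrelation A B A∈C B∈C A≢B τ =
        no-translated-pair⇒∣∩∣≤1 τ (proj₁ (All.lookup ks A∈C)) λ uv∈ u′v′∈ u′↦u v′↦v →
          A≢B (cong proj₁ (translated-pair⇒same (τ %ℕ n) A∈C B∈C uv∈ u′v′∈ u′↦u v′↦v))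

  DifferenceCertificate : ℕ → ℕ → List (List Point) → Set
  DifferenceCertificate m k C =
    Unique C × All (IsKSubset m n k) C × Unique (differences C) ×
    length (admissibleDifferences m) < k * pred k * suc (length C)

  certificate⇒optimal : ∀ {m k C} → DifferenceCertificate m k C → IsOptimal2DOOC m n k C
  certificate⇒optimal {m} {k} {C} (C! , ks , differences! , few-admissible) = ooc , λ C′ ooc′ →
    s≤s⁻¹ (*-cancelˡ-< (k * pred k) _ _ (≤-<-trans (Is2DOOC⇒size≤ ooc′) few-admissible))
    where
    ooc : Is2DOOC m n k C
    ooc = Unique-differences⇒Is2DOOC C! ks differences!

  inGrid? : ∀ m → Decidable (InGrid m n)
  inGrid? m (i , x) = (i <? m) ×-dec (x <? n)

  isKSubset? : ∀ m k → Decidable (IsKSubset m n k)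
  isKSubset? m k A = DecUnique.unique? _≟ₚ_ A ×-dec (length A ≟ k) ×-dec all? (inGrid? m) A

  certificate? : ∀ m k C → Dec (DifferenceCertificate m k C)
  certificate? m k C =
    DecUnique.unique? _≟ₗ_ C ×-dec all? (isKSubset? m k) C ×-dec DecUnique.unique? _≟ᵈ_ (differences C) ×-dec
    (length (admissibleDifferences m) <? k * pred k * suc (length C))

exceptional? : ∀ m n → Dec (Exceptional m n)
exceptional? m n =
  (((m * n) % 24 ≟ 14) ⊎-dec ((m * n) % 24 ≟ 20))
  ⊎-dec ((m % 6 ≟ 4) ×-dec (n ≟ 4))
  ⊎-dec (((m % 12 ≟ 5) ⊎-dec (m % 12 ≟ 8)) ×-dec (n ≟ 2))
  ⊎-dec ((m % 3 ≟ 0) ×-dec (((m * n) % 24 ≟ 6) ⊎-dec ((m * n) % 24 ≟ 12)))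

open Differences 6 using (certificate?; certificate⇒optimal)

code7 : List (List Point)
code7 =
  ((0 , 0) ∷ (1 , 2) ∷ (3 , 0) ∷ [])
  ∷ ((0 , 0) ∷ (4 , 5) ∷ (5 , 3) ∷ [])
  ∷ ((1 , 0) ∷ (1 , 2) ∷ (5 , 4) ∷ [])
  ∷ ((0 , 0) ∷ (2 , 2) ∷ (6 , 2) ∷ [])
  ∷ ((0 , 0) ∷ (3 , 2) ∷ (3 , 3) ∷ [])
  ∷ ((0 , 3) ∷ (4 , 0) ∷ (5 , 3) ∷ [])
  ∷ ((0 , 0) ∷ (0 , 1) ∷ (1 , 4) ∷ [])
  ∷ ((0 , 0) ∷ (2 , 1) ∷ (5 , 5) ∷ [])
  ∷ ((0 , 0) ∷ (3 , 5) ∷ (6 , 4) ∷ [])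
  ∷ ((1 , 0) ∷ (2 , 1) ∷ (6 , 5) ∷ [])
  ∷ ((0 , 0) ∷ (3 , 4) ∷ (5 , 2) ∷ [])
  ∷ ((0 , 0) ∷ (2 , 0) ∷ (6 , 3) ∷ [])
  ∷ ((1 , 0) ∷ (2 , 2) ∷ (3 , 1) ∷ [])
  ∷ ((2 , 0) ∷ (2 , 1) ∷ (5 , 3) ∷ [])
  ∷ ((0 , 0) ∷ (5 , 1) ∷ (6 , 0) ∷ [])
  ∷ ((2 , 1) ∷ (4 , 0) ∷ (5 , 0) ∷ [])
  ∷ ((2 , 0) ∷ (2 , 2) ∷ (6 , 1) ∷ [])
  ∷ ((0 , 0) ∷ (2 , 5) ∷ (4 , 2) ∷ [])
  ∷ ((0 , 0) ∷ (0 , 2) ∷ (4 , 0) ∷ [])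
  ∷ ((0 , 5) ∷ (1 , 0) ∷ (4 , 0) ∷ [])
  ∷ ((0 , 0) ∷ (1 , 0) ∷ (2 , 4) ∷ [])
  ∷ ((1 , 0) ∷ (2 , 3) ∷ (3 , 5) ∷ [])
  ∷ ((1 , 0) ∷ (3 , 0) ∷ (4 , 3) ∷ [])
  ∷ ((1 , 0) ∷ (2 , 0) ∷ (4 , 1) ∷ [])
  ∷ ((1 , 0) ∷ (1 , 5) ∷ (6 , 3) ∷ [])
  ∷ ((1 , 0) ∷ (5 , 5) ∷ (6 , 1) ∷ [])
  ∷ ((1 , 0) ∷ (5 , 1) ∷ (5 , 3) ∷ [])
  ∷ ((0 , 2) ∷ (5 , 0) ∷ (6 , 3) ∷ [])
  ∷ ((0 , 1) ∷ (1 , 0) ∷ (3 , 2) ∷ [])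
  ∷ ((3 , 0) ∷ (5 , 1) ∷ (6 , 2) ∷ [])
  ∷ ((0 , 0) ∷ (2 , 3) ∷ (6 , 5) ∷ [])
  ∷ ((4 , 5) ∷ (6 , 0) ∷ (6 , 1) ∷ [])
  ∷ ((1 , 0) ∷ (2 , 5) ∷ (4 , 5) ∷ [])
  ∷ ((1 , 0) ∷ (5 , 0) ∷ (6 , 0) ∷ [])
  ∷ ((2 , 0) ∷ (3 , 4) ∷ (5 , 1) ∷ [])
  ∷ ((3 , 0) ∷ (6 , 1) ∷ (6 , 3) ∷ [])
  ∷ ((3 , 0) ∷ (3 , 4) ∷ (6 , 4) ∷ [])
  ∷ ((4 , 0) ∷ (4 , 1) ∷ (6 , 0) ∷ [])
  ∷ ((1 , 2) ∷ (4 , 0) ∷ (6 , 4) ∷ [])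
  ∷ ((1 , 0) ∷ (3 , 3) ∷ (4 , 2) ∷ [])
  ∷ ((4 , 1) ∷ (5 , 0) ∷ (6 , 4) ∷ [])
  ∷ ((2 , 0) ∷ (4 , 4) ∷ (5 , 0) ∷ [])
  ∷ ((3 , 0) ∷ (5 , 0) ∷ (5 , 5) ∷ [])
  ∷ ((3 , 0) ∷ (4 , 1) ∷ (5 , 2) ∷ [])
  ∷ ((2 , 0) ∷ (3 , 0) ∷ (4 , 2) ∷ [])
  ∷ ((3 , 0) ∷ (4 , 0) ∷ (4 , 4) ∷ [])
  ∷ []

code8 : List (List Point)
code8 =
  ((1 , 4) ∷ (4 , 0) ∷ (7 , 5) ∷ [])
  ∷ ((1 , 0) ∷ (3 , 0) ∷ (7 , 4) ∷ [])
  ∷ ((2 , 4) ∷ (3 , 0) ∷ (6 , 2) ∷ [])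
  ∷ ((0 , 0) ∷ (2 , 2) ∷ (4 , 3) ∷ [])
  ∷ ((0 , 1) ∷ (1 , 0) ∷ (2 , 5) ∷ [])
  ∷ ((1 , 0) ∷ (2 , 2) ∷ (2 , 3) ∷ [])
  ∷ ((2 , 0) ∷ (3 , 4) ∷ (4 , 2) ∷ [])
  ∷ ((1 , 0) ∷ (3 , 3) ∷ (5 , 2) ∷ [])
  ∷ ((1 , 0) ∷ (1 , 2) ∷ (4 , 5) ∷ [])
  ∷ ((1 , 0) ∷ (6 , 0) ∷ (6 , 4) ∷ [])
  ∷ ((2 , 3) ∷ (3 , 0) ∷ (3 , 2) ∷ [])
  ∷ ((0 , 0) ∷ (1 , 4) ∷ (2 , 5) ∷ [])
  ∷ ((0 , 0) ∷ (3 , 4) ∷ (6 , 4) ∷ [])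
  ∷ ((0 , 0) ∷ (0 , 1) ∷ (4 , 2) ∷ [])
  ∷ ((0 , 0) ∷ (0 , 4) ∷ (1 , 1) ∷ [])
  ∷ ((2 , 3) ∷ (6 , 0) ∷ (7 , 2) ∷ [])
  ∷ ((0 , 0) ∷ (2 , 0) ∷ (7 , 3) ∷ [])
  ∷ ((2 , 0) ∷ (4 , 4) ∷ (6 , 0) ∷ [])
  ∷ ((0 , 1) ∷ (3 , 0) ∷ (6 , 3) ∷ [])
  ∷ ((0 , 3) ∷ (3 , 0) ∷ (4 , 2) ∷ [])
  ∷ ((0 , 0) ∷ (4 , 4) ∷ (7 , 2) ∷ [])
  ∷ ((0 , 0) ∷ (3 , 2) ∷ (7 , 4) ∷ [])
  ∷ ((0 , 0) ∷ (1 , 0) ∷ (4 , 0) ∷ [])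
  ∷ ((1 , 0) ∷ (3 , 2) ∷ (7 , 3) ∷ [])
  ∷ ((5 , 4) ∷ (6 , 0) ∷ (7 , 5) ∷ [])
  ∷ ((3 , 0) ∷ (4 , 1) ∷ (7 , 3) ∷ [])
  ∷ ((1 , 0) ∷ (3 , 1) ∷ (7 , 0) ∷ [])
  ∷ ((3 , 3) ∷ (4 , 0) ∷ (7 , 3) ∷ [])
  ∷ ((1 , 0) ∷ (2 , 4) ∷ (4 , 1) ∷ [])
  ∷ ((0 , 0) ∷ (1 , 2) ∷ (3 , 0) ∷ [])
  ∷ ((1 , 0) ∷ (1 , 5) ∷ (5 , 5) ∷ [])
  ∷ ((1 , 0) ∷ (6 , 2) ∷ (6 , 3) ∷ [])
  ∷ ((3 , 0) ∷ (3 , 1) ∷ (5 , 2) ∷ [])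
  ∷ ((4 , 0) ∷ (5 , 2) ∷ (6 , 0) ∷ [])
  ∷ ((3 , 0) ∷ (4 , 0) ∷ (6 , 5) ∷ [])
  ∷ ((0 , 0) ∷ (3 , 1) ∷ (6 , 5) ∷ [])
  ∷ ((0 , 0) ∷ (6 , 0) ∷ (7 , 1) ∷ [])
  ∷ ((0 , 0) ∷ (2 , 3) ∷ (5 , 5) ∷ [])
  ∷ ((0 , 0) ∷ (5 , 2) ∷ (5 , 4) ∷ [])
  ∷ ((2 , 0) ∷ (4 , 0) ∷ (7 , 0) ∷ [])
  ∷ ((4 , 0) ∷ (4 , 5) ∷ (5 , 4) ∷ [])
  ∷ ((2 , 0) ∷ (4 , 5) ∷ (5 , 5) ∷ [])
  ∷ ((2 , 0) ∷ (2 , 4) ∷ (6 , 5) ∷ [])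
  ∷ ((5 , 0) ∷ (6 , 5) ∷ (7 , 5) ∷ [])
  ∷ ((2 , 0) ∷ (3 , 0) ∷ (5 , 3) ∷ [])
  ∷ ((2 , 5) ∷ (7 , 0) ∷ (7 , 1) ∷ [])
  ∷ ((1 , 0) ∷ (2 , 0) ∷ (5 , 4) ∷ [])
  ∷ ((1 , 0) ∷ (6 , 5) ∷ (7 , 2) ∷ [])
  ∷ ((4 , 3) ∷ (5 , 0) ∷ (6 , 1) ∷ [])
  ∷ ((4 , 0) ∷ (4 , 4) ∷ (6 , 1) ∷ [])
  ∷ ((1 , 0) ∷ (5 , 1) ∷ (6 , 1) ∷ [])
  ∷ ((0 , 5) ∷ (6 , 0) ∷ (7 , 4) ∷ [])
  ∷ ((0 , 0) ∷ (5 , 3) ∷ (7 , 0) ∷ [])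
  ∷ ((2 , 0) ∷ (5 , 0) ∷ (7 , 4) ∷ [])
  ∷ ((0 , 0) ∷ (5 , 0) ∷ (5 , 1) ∷ [])
  ∷ ((0 , 0) ∷ (2 , 1) ∷ (6 , 3) ∷ [])
  ∷ ((2 , 0) ∷ (3 , 1) ∷ (5 , 1) ∷ [])
  ∷ ((3 , 2) ∷ (5 , 0) ∷ (6 , 3) ∷ [])
  ∷ ((1 , 0) ∷ (3 , 5) ∷ (4 , 4) ∷ [])
  ∷ ((1 , 0) ∷ (5 , 3) ∷ (7 , 5) ∷ [])
  ∷ ((4 , 0) ∷ (5 , 1) ∷ (7 , 1) ∷ [])
  ∷ []

code10 : List (List Point)
code10 =
  ((0 , 0) ∷ (7 , 1) ∷ (8 , 5) ∷ [])
  ∷ ((1 , 0) ∷ (3 , 3) ∷ (8 , 5) ∷ [])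
  ∷ ((1 , 0) ∷ (2 , 2) ∷ (6 , 2) ∷ [])
  ∷ ((2 , 3) ∷ (3 , 0) ∷ (3 , 1) ∷ [])
  ∷ ((1 , 5) ∷ (4 , 0) ∷ (8 , 1) ∷ [])
  ∷ ((2 , 4) ∷ (3 , 0) ∷ (5 , 2) ∷ [])
  ∷ ((2 , 0) ∷ (7 , 1) ∷ (8 , 2) ∷ [])
  ∷ ((4 , 0) ∷ (5 , 0) ∷ (9 , 2) ∷ [])
  ∷ ((2 , 1) ∷ (3 , 0) ∷ (6 , 3) ∷ [])
  ∷ ((3 , 0) ∷ (7 , 2) ∷ (7 , 3) ∷ [])
  ∷ ((2 , 0) ∷ (5 , 0) ∷ (9 , 0) ∷ [])
  ∷ ((5 , 0) ∷ (5 , 2) ∷ (9 , 5) ∷ [])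
  ∷ ((0 , 0) ∷ (4 , 2) ∷ (5 , 1) ∷ [])
  ∷ ((2 , 0) ∷ (2 , 5) ∷ (8 , 5) ∷ [])
  ∷ ((1 , 0) ∷ (3 , 4) ∷ (6 , 3) ∷ [])
  ∷ ((1 , 0) ∷ (2 , 0) ∷ (8 , 4) ∷ [])
  ∷ ((0 , 0) ∷ (1 , 5) ∷ (8 , 2) ∷ [])
  ∷ ((4 , 0) ∷ (8 , 2) ∷ (9 , 5) ∷ [])
  ∷ ((2 , 0) ∷ (4 , 4) ∷ (5 , 2) ∷ [])
  ∷ ((1 , 0) ∷ (2 , 5) ∷ (9 , 2) ∷ [])
  ∷ ((0 , 0) ∷ (1 , 1) ∷ (2 , 2) ∷ [])
  ∷ ((0 , 0) ∷ (1 , 0) ∷ (2 , 4) ∷ [])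
  ∷ ((4 , 0) ∷ (6 , 2) ∷ (8 , 0) ∷ [])
  ∷ ((5 , 0) ∷ (8 , 3) ∷ (9 , 4) ∷ [])
  ∷ ((1 , 1) ∷ (4 , 0) ∷ (4 , 1) ∷ [])
  ∷ ((5 , 0) ∷ (7 , 2) ∷ (9 , 1) ∷ [])
  ∷ ((1 , 0) ∷ (1 , 4) ∷ (5 , 1) ∷ [])
  ∷ ((0 , 0) ∷ (3 , 4) ∷ (4 , 5) ∷ [])
  ∷ ((1 , 0) ∷ (1 , 5) ∷ (6 , 5) ∷ [])
  ∷ ((0 , 0) ∷ (6 , 3) ∷ (9 , 2) ∷ [])
  ∷ ((1 , 0) ∷ (5 , 2) ∷ (6 , 4) ∷ [])
  ∷ ((1 , 0) ∷ (5 , 0) ∷ (7 , 4) ∷ [])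
  ∷ ((0 , 2) ∷ (1 , 0) ∷ (8 , 0) ∷ [])
  ∷ ((1 , 0) ∷ (6 , 1) ∷ (8 , 1) ∷ [])
  ∷ ((0 , 0) ∷ (2 , 5) ∷ (7 , 2) ∷ [])
  ∷ ((2 , 0) ∷ (7 , 4) ∷ (8 , 1) ∷ [])
  ∷ ((1 , 0) ∷ (2 , 3) ∷ (9 , 5) ∷ [])
  ∷ ((2 , 0) ∷ (4 , 3) ∷ (4 , 5) ∷ [])
  ∷ ((0 , 0) ∷ (4 , 0) ∷ (7 , 0) ∷ [])
  ∷ ((4 , 0) ∷ (8 , 3) ∷ (8 , 5) ∷ [])
  ∷ ((0 , 0) ∷ (2 , 3) ∷ (5 , 2) ∷ [])
  ∷ ((3 , 4) ∷ (6 , 0) ∷ (9 , 2) ∷ [])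
  ∷ ((1 , 0) ∷ (3 , 5) ∷ (5 , 5) ∷ [])
  ∷ ((0 , 0) ∷ (9 , 3) ∷ (9 , 4) ∷ [])
  ∷ ((0 , 0) ∷ (1 , 3) ∷ (3 , 3) ∷ [])
  ∷ ((1 , 0) ∷ (3 , 2) ∷ (7 , 1) ∷ [])
  ∷ ((1 , 0) ∷ (7 , 2) ∷ (9 , 0) ∷ [])
  ∷ ((3 , 3) ∷ (8 , 0) ∷ (9 , 0) ∷ [])
  ∷ ((0 , 0) ∷ (1 , 2) ∷ (9 , 0) ∷ [])
  ∷ ((3 , 2) ∷ (4 , 0) ∷ (5 , 3) ∷ [])
  ∷ ((2 , 3) ∷ (6 , 0) ∷ (9 , 1) ∷ [])
  ∷ ((3 , 0) ∷ (4 , 0) ∷ (7 , 1) ∷ [])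
  ∷ ((1 , 0) ∷ (4 , 4) ∷ (7 , 3) ∷ [])
  ∷ ((2 , 5) ∷ (5 , 0) ∷ (8 , 2) ∷ [])
  ∷ ((0 , 0) ∷ (3 , 5) ∷ (5 , 3) ∷ [])
  ∷ ((3 , 0) ∷ (3 , 2) ∷ (9 , 1) ∷ [])
  ∷ ((3 , 0) ∷ (4 , 3) ∷ (6 , 1) ∷ [])
  ∷ ((0 , 0) ∷ (5 , 5) ∷ (7 , 5) ∷ [])
  ∷ ((0 , 0) ∷ (4 , 4) ∷ (9 , 5) ∷ [])
  ∷ ((1 , 3) ∷ (4 , 0) ∷ (5 , 1) ∷ [])
  ∷ ((0 , 0) ∷ (2 , 1) ∷ (7 , 3) ∷ [])
  ∷ ((2 , 0) ∷ (6 , 1) ∷ (9 , 1) ∷ [])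
  ∷ ((2 , 0) ∷ (5 , 3) ∷ (7 , 0) ∷ [])
  ∷ ((2 , 0) ∷ (4 , 1) ∷ (9 , 5) ∷ [])
  ∷ ((5 , 1) ∷ (7 , 0) ∷ (8 , 5) ∷ [])
  ∷ ((6 , 0) ∷ (6 , 4) ∷ (7 , 1) ∷ [])
  ∷ ((6 , 0) ∷ (7 , 0) ∷ (9 , 3) ∷ [])
  ∷ ((7 , 0) ∷ (9 , 0) ∷ (9 , 2) ∷ [])
  ∷ ((1 , 0) ∷ (3 , 1) ∷ (9 , 3) ∷ [])
  ∷ ((1 , 0) ∷ (7 , 0) ∷ (9 , 1) ∷ [])
  ∷ ((3 , 0) ∷ (8 , 1) ∷ (9 , 0) ∷ [])
  ∷ ((1 , 0) ∷ (4 , 2) ∷ (7 , 5) ∷ [])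
  ∷ ((3 , 1) ∷ (5 , 0) ∷ (7 , 1) ∷ [])
  ∷ ((4 , 4) ∷ (5 , 0) ∷ (6 , 5) ∷ [])
  ∷ ((3 , 0) ∷ (6 , 0) ∷ (8 , 5) ∷ [])
  ∷ ((4 , 1) ∷ (6 , 0) ∷ (9 , 4) ∷ [])
  ∷ ((2 , 0) ∷ (2 , 2) ∷ (4 , 2) ∷ [])
  ∷ ((0 , 0) ∷ (3 , 2) ∷ (4 , 1) ∷ [])
  ∷ ((4 , 0) ∷ (8 , 4) ∷ (9 , 0) ∷ [])
  ∷ ((2 , 5) ∷ (3 , 0) ∷ (7 , 4) ∷ [])
  ∷ ((0 , 3) ∷ (8 , 0) ∷ (9 , 4) ∷ [])
  ∷ ((2 , 0) ∷ (3 , 0) ∷ (6 , 4) ∷ [])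
  ∷ ((0 , 0) ∷ (2 , 0) ∷ (6 , 5) ∷ [])
  ∷ ((0 , 5) ∷ (3 , 0) ∷ (4 , 2) ∷ [])
  ∷ ((0 , 0) ∷ (3 , 0) ∷ (8 , 0) ∷ [])
  ∷ ((0 , 0) ∷ (0 , 2) ∷ (5 , 0) ∷ [])
  ∷ ((3 , 0) ∷ (5 , 3) ∷ (8 , 4) ∷ [])
  ∷ ((0 , 0) ∷ (6 , 4) ∷ (8 , 1) ∷ [])
  ∷ ((5 , 0) ∷ (8 , 0) ∷ (8 , 5) ∷ [])
  ∷ ((5 , 0) ∷ (5 , 5) ∷ (6 , 3) ∷ [])
  ∷ ((0 , 0) ∷ (0 , 5) ∷ (6 , 1) ∷ [])
  ∷ ((0 , 0) ∷ (6 , 0) ∷ (7 , 4) ∷ [])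
  ∷ ((5 , 0) ∷ (6 , 0) ∷ (6 , 1) ∷ [])
  ∷ ((6 , 0) ∷ (7 , 2) ∷ (8 , 2) ∷ [])
  ∷ ((6 , 1) ∷ (7 , 0) ∷ (8 , 2) ∷ [])
  ∷ ((4 , 0) ∷ (7 , 2) ∷ (7 , 4) ∷ [])
  ∷ []

code11 : List (List Point)
code11 =
  ((0 , 1) ∷ (7 , 0) ∷ (8 , 2) ∷ [])
  ∷ ((1 , 2) ∷ (6 , 0) ∷ (8 , 1) ∷ [])
  ∷ ((7 , 0) ∷ (8 , 5) ∷ (10 , 1) ∷ [])
  ∷ ((1 , 0) ∷ (4 , 0) ∷ (8 , 1) ∷ [])
  ∷ ((2 , 0) ∷ (3 , 3) ∷ (8 , 3) ∷ [])
  ∷ ((0 , 0) ∷ (3 , 0) ∷ (5 , 4) ∷ [])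
  ∷ ((0 , 0) ∷ (3 , 1) ∷ (10 , 4) ∷ [])
  ∷ ((3 , 0) ∷ (8 , 1) ∷ (10 , 4) ∷ [])
  ∷ ((0 , 0) ∷ (1 , 2) ∷ (8 , 5) ∷ [])
  ∷ ((1 , 0) ∷ (8 , 2) ∷ (9 , 1) ∷ [])
  ∷ ((0 , 1) ∷ (2 , 0) ∷ (8 , 4) ∷ [])
  ∷ ((0 , 0) ∷ (0 , 2) ∷ (8 , 4) ∷ [])
  ∷ ((7 , 0) ∷ (8 , 4) ∷ (10 , 2) ∷ [])
  ∷ ((0 , 4) ∷ (9 , 0) ∷ (10 , 1) ∷ [])
  ∷ ((1 , 0) ∷ (2 , 1) ∷ (7 , 3) ∷ [])
  ∷ ((1 , 0) ∷ (4 , 2) ∷ (7 , 4) ∷ [])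
  ∷ ((2 , 0) ∷ (3 , 0) ∷ (4 , 4) ∷ [])
  ∷ ((4 , 0) ∷ (8 , 0) ∷ (10 , 0) ∷ [])
  ∷ ((5 , 0) ∷ (8 , 1) ∷ (8 , 2) ∷ [])
  ∷ ((2 , 2) ∷ (5 , 0) ∷ (9 , 4) ∷ [])
  ∷ ((1 , 0) ∷ (4 , 3) ∷ (8 , 0) ∷ [])
  ∷ ((0 , 0) ∷ (1 , 5) ∷ (7 , 1) ∷ [])
  ∷ ((3 , 0) ∷ (8 , 4) ∷ (9 , 5) ∷ [])
  ∷ ((1 , 0) ∷ (4 , 1) ∷ (5 , 2) ∷ [])
  ∷ ((0 , 5) ∷ (5 , 0) ∷ (7 , 2) ∷ [])
  ∷ ((6 , 0) ∷ (7 , 2) ∷ (8 , 2) ∷ [])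
  ∷ ((3 , 0) ∷ (3 , 5) ∷ (7 , 0) ∷ [])
  ∷ ((4 , 0) ∷ (7 , 4) ∷ (10 , 2) ∷ [])
  ∷ ((4 , 0) ∷ (8 , 5) ∷ (10 , 4) ∷ [])
  ∷ ((0 , 0) ∷ (1 , 3) ∷ (3 , 3) ∷ [])
  ∷ ((1 , 5) ∷ (5 , 0) ∷ (7 , 4) ∷ [])
  ∷ ((1 , 0) ∷ (4 , 4) ∷ (9 , 2) ∷ [])
  ∷ ((5 , 4) ∷ (6 , 0) ∷ (8 , 3) ∷ [])
  ∷ ((0 , 0) ∷ (4 , 0) ∷ (5 , 5) ∷ [])
  ∷ ((0 , 3) ∷ (4 , 0) ∷ (4 , 2) ∷ [])
  ∷ ((1 , 0) ∷ (2 , 0) ∷ (3 , 4) ∷ [])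
  ∷ ((3 , 1) ∷ (4 , 0) ∷ (8 , 4) ∷ [])
  ∷ ((0 , 0) ∷ (3 , 2) ∷ (6 , 0) ∷ [])
  ∷ ((1 , 0) ∷ (3 , 1) ∷ (3 , 3) ∷ [])
  ∷ ((3 , 0) ∷ (4 , 0) ∷ (6 , 3) ∷ [])
  ∷ ((3 , 3) ∷ (4 , 0) ∷ (6 , 2) ∷ [])
  ∷ ((4 , 0) ∷ (5 , 4) ∷ (6 , 1) ∷ [])
  ∷ ((0 , 4) ∷ (2 , 0) ∷ (3 , 2) ∷ [])
  ∷ ((0 , 3) ∷ (2 , 0) ∷ (6 , 4) ∷ [])
  ∷ ((1 , 2) ∷ (2 , 0) ∷ (10 , 5) ∷ [])
  ∷ ((3 , 0) ∷ (4 , 2) ∷ (7 , 5) ∷ [])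
  ∷ ((0 , 0) ∷ (1 , 4) ∷ (6 , 5) ∷ [])
  ∷ ((0 , 4) ∷ (4 , 0) ∷ (6 , 0) ∷ [])
  ∷ ((3 , 0) ∷ (4 , 1) ∷ (10 , 0) ∷ [])
  ∷ ((3 , 0) ∷ (5 , 0) ∷ (10 , 2) ∷ [])
  ∷ ((1 , 0) ∷ (1 , 5) ∷ (10 , 5) ∷ [])
  ∷ ((6 , 0) ∷ (7 , 3) ∷ (9 , 3) ∷ [])
  ∷ ((0 , 0) ∷ (2 , 1) ∷ (5 , 2) ∷ [])
  ∷ ((0 , 0) ∷ (0 , 5) ∷ (1 , 0) ∷ [])
  ∷ ((0 , 0) ∷ (10 , 0) ∷ (10 , 2) ∷ [])
  ∷ ((7 , 5) ∷ (8 , 0) ∷ (9 , 3) ∷ [])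
  ∷ ((7 , 3) ∷ (9 , 0) ∷ (10 , 3) ∷ [])
  ∷ ((0 , 0) ∷ (7 , 0) ∷ (7 , 4) ∷ [])
  ∷ ((1 , 5) ∷ (7 , 0) ∷ (10 , 3) ∷ [])
  ∷ ((1 , 0) ∷ (4 , 5) ∷ (10 , 2) ∷ [])
  ∷ ((1 , 0) ∷ (9 , 5) ∷ (10 , 1) ∷ [])
  ∷ ((4 , 1) ∷ (6 , 0) ∷ (7 , 0) ∷ [])
  ∷ ((1 , 0) ∷ (1 , 2) ∷ (6 , 2) ∷ [])
  ∷ ((2 , 0) ∷ (4 , 1) ∷ (4 , 2) ∷ [])
  ∷ ((1 , 0) ∷ (5 , 0) ∷ (5 , 4) ∷ [])
  ∷ ((5 , 0) ∷ (8 , 0) ∷ (8 , 4) ∷ [])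
  ∷ ((3 , 4) ∷ (8 , 0) ∷ (9 , 0) ∷ [])
  ∷ ((1 , 4) ∷ (3 , 0) ∷ (9 , 1) ∷ [])
  ∷ ((1 , 0) ∷ (3 , 5) ∷ (8 , 4) ∷ [])
  ∷ ((6 , 0) ∷ (6 , 1) ∷ (8 , 0) ∷ [])
  ∷ ((2 , 0) ∷ (6 , 2) ∷ (7 , 1) ∷ [])
  ∷ ((3 , 0) ∷ (6 , 0) ∷ (9 , 4) ∷ [])
  ∷ ((2 , 0) ∷ (8 , 1) ∷ (9 , 5) ∷ [])
  ∷ ((1 , 1) ∷ (5 , 0) ∷ (9 , 5) ∷ [])
  ∷ ((2 , 0) ∷ (5 , 3) ∷ (9 , 3) ∷ [])
  ∷ ((4 , 3) ∷ (5 , 0) ∷ (6 , 1) ∷ [])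
  ∷ ((1 , 0) ∷ (2 , 2) ∷ (6 , 3) ∷ [])
  ∷ ((2 , 0) ∷ (6 , 0) ∷ (7 , 4) ∷ [])
  ∷ ((0 , 0) ∷ (7 , 2) ∷ (9 , 4) ∷ [])
  ∷ ((2 , 0) ∷ (7 , 3) ∷ (8 , 0) ∷ [])
  ∷ ((0 , 0) ∷ (2 , 0) ∷ (3 , 5) ∷ [])
  ∷ ((0 , 0) ∷ (5 , 0) ∷ (10 , 5) ∷ [])
  ∷ ((0 , 0) ∷ (2 , 4) ∷ (6 , 3) ∷ [])
  ∷ ((2 , 0) ∷ (5 , 2) ∷ (8 , 5) ∷ [])
  ∷ ((2 , 0) ∷ (6 , 3) ∷ (10 , 0) ∷ [])
  ∷ ((6 , 0) ∷ (8 , 4) ∷ (9 , 0) ∷ [])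
  ∷ ((0 , 2) ∷ (6 , 0) ∷ (9 , 5) ∷ [])
  ∷ ((0 , 0) ∷ (8 , 0) ∷ (10 , 1) ∷ [])
  ∷ ((2 , 0) ∷ (4 , 0) ∷ (8 , 2) ∷ [])
  ∷ ((0 , 0) ∷ (4 , 1) ∷ (5 , 3) ∷ [])
  ∷ ((2 , 0) ∷ (3 , 1) ∷ (9 , 1) ∷ [])
  ∷ ((3 , 0) ∷ (5 , 5) ∷ (10 , 5) ∷ [])
  ∷ ((4 , 0) ∷ (7 , 0) ∷ (9 , 1) ∷ [])
  ∷ ((4 , 0) ∷ (7 , 1) ∷ (9 , 0) ∷ [])
  ∷ ((3 , 4) ∷ (7 , 0) ∷ (10 , 5) ∷ [])
  ∷ ((3 , 0) ∷ (5 , 1) ∷ (7 , 4) ∷ [])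
  ∷ ((1 , 0) ∷ (5 , 3) ∷ (9 , 0) ∷ [])
  ∷ ((1 , 0) ∷ (6 , 5) ∷ (7 , 0) ∷ [])
  ∷ ((6 , 5) ∷ (9 , 0) ∷ (10 , 0) ∷ [])
  ∷ ((6 , 0) ∷ (6 , 2) ∷ (10 , 2) ∷ [])
  ∷ ((5 , 2) ∷ (6 , 0) ∷ (10 , 5) ∷ [])
  ∷ ((3 , 0) ∷ (6 , 1) ∷ (9 , 3) ∷ [])
  ∷ ((3 , 3) ∷ (5 , 0) ∷ (6 , 5) ∷ [])
  ∷ ((3 , 0) ∷ (5 , 2) ∷ (7 , 3) ∷ [])
  ∷ ((2 , 0) ∷ (7 , 0) ∷ (7 , 5) ∷ [])
  ∷ ((5 , 0) ∷ (5 , 5) ∷ (7 , 5) ∷ [])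
  ∷ ((9 , 0) ∷ (10 , 4) ∷ (10 , 5) ∷ [])
  ∷ ((5 , 0) ∷ (6 , 0) ∷ (10 , 4) ∷ [])
  ∷ ((2 , 0) ∷ (2 , 5) ∷ (10 , 2) ∷ [])
  ∷ ((2 , 0) ∷ (5 , 0) ∷ (10 , 1) ∷ [])
  ∷ ((2 , 3) ∷ (4 , 0) ∷ (10 , 1) ∷ [])
  ∷ ((1 , 0) ∷ (2 , 3) ∷ (2 , 5) ∷ [])
  ∷ ((2 , 0) ∷ (4 , 5) ∷ (9 , 4) ∷ [])
  ∷ ((2 , 0) ∷ (5 , 5) ∷ (9 , 0) ∷ [])
  ∷ ((4 , 0) ∷ (5 , 0) ∷ (9 , 2) ∷ [])
  ∷ ((0 , 2) ∷ (4 , 0) ∷ (9 , 3) ∷ [])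
  ∷ ((0 , 0) ∷ (9 , 0) ∷ (9 , 5) ∷ [])
  ∷ []


J-attained : ∀ m C {certified : True (certificate? m 3 C)} {unexceptional : False (exceptional? m 6)} →
             length C ≡ J m 6 → Σ (List (List Point)) (λ C → IsOptimal2DOOC m 6 3 C × JStar m 6 (length C))
J-attained m C {certified} {unexceptional} |C|≡J =
  C , certificate⇒optimal (toWitness certified) , inj₂ (toWitnessFalse unexceptional , |C|≡J)

lemma8p4 : (m : ℕ) → (m ≡ 7 ⊎ m ≡ 8 ⊎ m ≡ 10 ⊎ m ≡ 11) →
    Σ (List (List Point)) (λ C → IsOptimal2DOOC m 6 3 C × JStar m 6 (length C))
lemma8p4 _ (inj₁ refl)                = J-attained 7 code7 refl
lemma8p4 _ (inj₂ (inj₁ refl))         = J-attained 8 code8 refl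
lemma8p4 _ (inj₂ (inj₂ (inj₁ refl)))  = J-attained 10 code10 refl
lemma8p4 _ (inj₂ (inj₂ (inj₂ refl)))  = J-attained 11 code11 refl
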